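{- Every graph with minimum degree $\delta$, maximum degree $\Delta\geq 3$ and diameter $k$ has at most $2\delta(\Delta-1)^{k-1}+1$ vertices. -}

module Defs where

open import Data.Nat using (ℕ; zero; suc; _≤_)
open import Data.Bool using (Bool; true; false; T)
open import Data.Fin using (Fin)
open import Data.List using (List; filter; length)
open import Data.List using () renaming (allFin to allFinL)
open import Data.Product using (Σ; ∃; _×_; _,_)
open import Relation.Binary.PropositionalEquality using (_≡_)
open import Relation.Nullary using (¬_)
open import Data.Bool.Properties using (T?)

record Graph (n : ℕ) : Set where
  field
    adj   : Fin n → Fin n → Bool
    sym   : ∀ u v → adj u v ≡ adj v u
    irrefl : ∀ v → adj v v ≡ false

open Graph public

degree : ∀ {n} → Graph n → Fin n → ℕ
degree G v = length (filter (λ u → T? (adj G v u)) (allFinL _))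

data Walk {n : ℕ} (G : Graph n) : Fin n → Fin n → ℕ → Set where
  here : ∀ {v} → Walk G v v zero
  step : ∀ {u w v ℓ} → T (adj G u w) → Walk G w v ℓ → Walk G u v (suc ℓ)

DistLe : ∀ {n} → Graph n → Fin n → Fin n → ℕ → Set
DistLe G u v ℓ = Σ ℕ λ m → m ≤ ℓ × Walk G u v m

-- Minimum degree is δ (the minimum is attained, so the graph is nonempty)
MinDegree : ∀ {n} → Graph n → ℕ → Set
MinDegree G δ = (∀ v → δ ≤ degree G v) × ∃ λ v → degree G v ≡ δ

MaxDegree : ∀ {n} → Graph n → ℕ → Set
MaxDegree G Δ = (∀ v → degree G v ≤ Δ) × ∃ λ v → degree G v ≡ Δ

Diameter : ∀ {n} → Graph n → ℕ → Set
Diameter G k =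
  (∀ u v → DistLe G u v k) ×
  (∃ λ u → ∃ λ v → DistLe G u v k × (∀ m → m Data.Nat.< k → ¬ DistLe G u v m))
  where import Data.Nat

module Submission where

open import Defs hiding (sym)
open import Data.Nat using (ℕ; zero; suc; _≤_; _<_; _≤′_; ≤′-refl; ≤′-step; z≤n; s≤s; _+_; _*_; _∸_; _^_)
open import Data.Nat.Properties
  using (≤-refl; ≤-trans; ≤-reflexive; ≤⇒≤′; +-mono-≤; +-comm; +-identityʳ; *-assoc; *-comm;
         *-suc; *-identityʳ; *-zeroʳ; *-distribˡ-+; *-monoˡ-≤; *-monoʳ-≤; ∸-monoˡ-≤; module ≤-Reasoning)
open import Data.Bool using (T)
open import Data.Bool.Properties using (T?)
open import Data.Fin using (Fin)
open import Data.Fin.Properties using (_≟_; injective⇒≤)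
open import Data.List using (List; []; _∷_; _++_; map; filter; concatMap; length; lookup)
open import Data.List using () renaming (allFin to allFinL)
open import Data.List.Properties using (length-map; length-++; filter-notAll)
open import Data.List.Membership.Propositional using (_∈_; find; lose)
open import Data.List.Membership.Propositional.Properties
  using (∈-map⁺; ∈-map⁻; ∈-++⁺ˡ; ∈-++⁺ʳ; ∈-++⁻; ∈-filter⁺; ∈-filter⁻; ∈-allFin; ∈-concatMap⁺; ∈-concatMap⁻)
open import Data.List.Relation.Unary.Any as Any using (here; there)
open import Data.List.Relation.Unary.Any.Properties using (lookup-index)
open import Data.Product using (_×_; _,_; proj₁; proj₂)
open import Data.Sum using (inj₁; inj₂)
open import Function using (id; _∘_)
open import Relation.Binary.PropositionalEquality using (refl; sym; trans; cong; subst)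
open import Relation.Nullary using (yes; no; ¬?)

-- Fix a vertex v of minimum degree δ and let d = Δ − 1. There are at most δ d^m
-- non-backtracking walks of length m + 1 out of v, and every vertex within distance k
-- of v is v itself or the endpoint of such a walk with m < k. Hence
-- n ≤ 1 + δ (1 + d + … + d^(k−1)) ≤ 1 + 2δ d^(k−1), the last step because d ≥ 2.

covering⇒length≥ : ∀ {n} (xs : List (Fin n)) → (∀ u → u ∈ xs) → n ≤ length xs
covering⇒length≥ xs covers = injective⇒≤ {f = Any.index ∘ covers} λ {u} {w} eq →
  trans (lookup-index (covers u)) (trans (cong (lookup xs) eq) (sym (lookup-index (covers w))))

length-concatMap-≤ : ∀ {A B : Set} (f : A → List B) (d : ℕ) (xs : List A) →
  (∀ x → x ∈ xs → length (f x) ≤ d) → length (concatMap f xs) ≤ d * length xs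
length-concatMap-≤ f d [] _ = z≤n
length-concatMap-≤ f d (x ∷ xs) bound = begin
  length (f x ++ concatMap f xs)          ≡⟨ length-++ (f x) ⟩
  length (f x) + length (concatMap f xs)  ≤⟨ +-mono-≤ (bound x (here refl))
                                               (length-concatMap-≤ f d xs (λ y → bound y ∘ there)) ⟩
  d + d * length xs                       ≡⟨ sym (*-suc d (length xs)) ⟩
  d * suc (length xs)                     ∎
  where open ≤-Reasoning

geometricSum : ℕ → ℕ → ℕ
geometricSum d zero    = 0
geometricSum d (suc k) = geometricSum d k + d ^ k

geometricSum-suc-≤ : ∀ {d} → 2 ≤ d → ∀ k → geometricSum d (suc k) ≤ 2 * d ^ k
geometricSum-suc-≤ 2≤d zero    = s≤s z≤n
geometricSum-suc-≤ {d} 2≤d (suc k) = begin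
  geometricSum d (suc k) + d ^ suc k  ≤⟨ +-mono-≤ (geometricSum-suc-≤ 2≤d k) ≤-refl ⟩
  2 * d ^ k + d ^ suc k               ≤⟨ +-mono-≤ (*-monoˡ-≤ (d ^ k) 2≤d) ≤-refl ⟩
  d ^ suc k + d ^ suc k               ≡⟨ cong (d ^ suc k +_) (sym (+-identityʳ (d ^ suc k))) ⟩
  2 * d ^ suc k                       ∎
  where open ≤-Reasoning

geometricSum-≤ : ∀ {d} → 2 ≤ d → ∀ k → geometricSum d k ≤ 2 * d ^ (k ∸ 1)
geometricSum-≤ 2≤d zero    = z≤n
geometricSum-≤ 2≤d (suc k) = geometricSum-suc-≤ 2≤d k

module _ {n : ℕ} (G : Graph n) where

  neighbours : Fin n → List (Fin n)
  neighbours c = filter (λ u → T? (adj G c u)) (allFinL n)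

  ∈-neighbours⁺ : ∀ {c u} → T (adj G c u) → u ∈ neighbours c
  ∈-neighbours⁺ {u = u} = ∈-filter⁺ (λ w → T? (adj G _ w)) (∈-allFin u)

  ∈-neighbours⁻ : ∀ {c u} → u ∈ neighbours c → T (adj G u c)
  ∈-neighbours⁻ {c} {u} u∈ =
    subst T (Graph.sym G c u) (proj₂ (∈-filter⁻ (λ w → T? (adj G c w)) {xs = allFinL n} u∈))

  Arc : Set
  Arc = Fin n × Fin n

  nonBacktrackingSuccessors : Arc → List Arc
  nonBacktrackingSuccessors (p , c) = map (c ,_) (filter (λ w → ¬? (w ≟ p)) (neighbours c))

  length-nonBacktrackingSuccessors : ∀ {p c} → T (adj G c p) →
    length (nonBacktrackingSuccessors (p , c)) < degree G c
  length-nonBacktrackingSuccessors {p} {c} cp =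
    subst (_< degree G c) (sym (length-map (c ,_) (filter (λ w → ¬? (w ≟ p)) (neighbours c))))
      (filter-notAll (λ w → ¬? (w ≟ p)) (neighbours c)
        (Any.map (λ p≡w p≢w → p≢w (sym p≡w)) (∈-neighbours⁺ cp)))

  module NonBacktrackingBalls (v : Fin n) where

    -- layer m lists the final arcs of the non-backtracking walks of length m + 1 out of v.
    layer : ℕ → List Arc
    layer zero    = map (v ,_) (neighbours v)
    layer (suc m) = concatMap nonBacktrackingSuccessors (layer m)

    ball : ℕ → List (Fin n)
    ball zero    = v ∷ []
    ball (suc m) = ball m ++ map proj₂ (layer m)

    layer-reversible : ∀ m {p c} → (p , c) ∈ layer m → T (adj G c p)
    layer-reversible zero pc∈ with ∈-map⁻ (v ,_) pc∈
    ... | _ , c∈ , refl = ∈-neighbours⁻ c∈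
    layer-reversible (suc m) pc∈ with find (∈-concatMap⁻ nonBacktrackingSuccessors {xs = layer m} pc∈)
    ... | (q , p) , _ , pc∈succ with ∈-map⁻ (p ,_) pc∈succ
    ... | _ , c∈ , refl = ∈-neighbours⁻ (proj₁ (∈-filter⁻ (λ w → ¬? (w ≟ q)) c∈))

    length-layer : ∀ {Δ} → (∀ c → degree G c ≤ Δ) → ∀ m →
      length (layer m) ≤ degree G v * (Δ ∸ 1) ^ m
    length-layer maxDeg zero =
      ≤-reflexive (trans (length-map (v ,_) (neighbours v)) (sym (*-identityʳ _)))
    length-layer {Δ} maxDeg (suc m) = begin
      length (layer (suc m))               ≤⟨ length-concatMap-≤ nonBacktrackingSuccessors d (layer m)
                                                successors≤ ⟩
      d * length (layer m)                 ≤⟨ *-monoʳ-≤ d (length-layer maxDeg m) ⟩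
      d * (degree G v * d ^ m)             ≡⟨ sym (*-assoc d (degree G v) (d ^ m)) ⟩
      d * degree G v * d ^ m               ≡⟨ cong (_* d ^ m) (*-comm d (degree G v)) ⟩
      degree G v * d * d ^ m               ≡⟨ *-assoc (degree G v) d (d ^ m) ⟩
      degree G v * d ^ suc m               ∎
      where
      open ≤-Reasoning
      d = Δ ∸ 1
      successors≤ : ∀ pc → pc ∈ layer m → length (nonBacktrackingSuccessors pc) ≤ d
      successors≤ (p , c) pc∈ =
        ∸-monoˡ-≤ 1 (≤-trans (length-nonBacktrackingSuccessors (layer-reversible m pc∈)) (maxDeg c))

    length-ball : ∀ {Δ} → (∀ c → degree G c ≤ Δ) → ∀ m →
      length (ball m) ≤ suc (degree G v * geometricSum (Δ ∸ 1) m)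
    length-ball maxDeg zero = s≤s (≤-reflexive (sym (*-zeroʳ (degree G v))))
    length-ball {Δ} maxDeg (suc m) = begin
      length (ball m ++ map proj₂ (layer m))         ≡⟨ length-++ (ball m) ⟩
      length (ball m) + length (map proj₂ (layer m)) ≡⟨ cong (length (ball m) +_) (length-map proj₂ (layer m)) ⟩
      length (ball m) + length (layer m)             ≤⟨ +-mono-≤ (length-ball maxDeg m) (length-layer maxDeg m) ⟩
      suc (δ * geometricSum d m + δ * d ^ m)         ≡⟨ cong suc (sym (*-distribˡ-+ δ (geometricSum d m) (d ^ m))) ⟩
      suc (δ * geometricSum d (suc m))               ∎
      where
      open ≤-Reasoning
      d = Δ ∸ 1
      δ = degree G v

    ball-mono : ∀ {m k u} → m ≤′ k → u ∈ ball m → u ∈ ball k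
    ball-mono ≤′-refl        = id
    ball-mono (≤′-step m≤′k) = ∈-++⁺ˡ ∘ ball-mono m≤′k

    tail∈ball : ∀ m {p c} → (p , c) ∈ layer m → p ∈ ball (suc m)
    tail∈ball zero pc∈ with ∈-map⁻ (v ,_) pc∈
    ... | _ , _ , refl = here refl
    tail∈ball (suc m) pc∈ with find (∈-concatMap⁻ nonBacktrackingSuccessors {xs = layer m} pc∈)
    ... | (q , p) , qp∈ , pc∈succ with ∈-map⁻ (p ,_) pc∈succ
    ... | _ , _ , refl = ∈-++⁺ˡ (∈-++⁺ʳ (ball m) (∈-map⁺ proj₂ qp∈))

    -- If w is the head of an arc (p , w) of layer m, a neighbour u of w either is p,
    -- which lies in the ball already, or continues the walk without backtracking.
    adjacent-∈ball : ∀ m {u w} → T (adj G u w) → w ∈ ball m → u ∈ ball (suc m)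
    adjacent-∈ball zero {u} uw (here refl) =
      there (∈-map⁺ proj₂ (∈-map⁺ (v ,_) (∈-neighbours⁺ (subst T (Graph.sym G u v) uw))))
    adjacent-∈ball (suc m) {u} uw w∈ with ∈-++⁻ (ball m) w∈
    ... | inj₁ w∈ball = ∈-++⁺ˡ (adjacent-∈ball m uw w∈ball)
    ... | inj₂ w∈heads with ∈-map⁻ proj₂ w∈heads
    ...   | (p , w) , pw∈ , refl with u ≟ p
    ...     | yes refl = ∈-++⁺ˡ (tail∈ball m pw∈)
    ...     | no u≢p   = ∈-++⁺ʳ (ball (suc m)) (∈-map⁺ proj₂ (∈-concatMap⁺ nonBacktrackingSuccessors (lose pw∈ wu∈succ)))
      where
      wu∈succ : (w , u) ∈ nonBacktrackingSuccessors (p , w)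
      wu∈succ = ∈-map⁺ (w ,_) (∈-filter⁺ (λ x → ¬? (x ≟ p))
                  (∈-neighbours⁺ (subst T (Graph.sym G u w) uw)) u≢p)

    walk⇒∈ball : ∀ {u m} → Walk G u v m → u ∈ ball m
    walk⇒∈ball here                 = here refl
    walk⇒∈ball (step {ℓ = ℓ} uw wv) = adjacent-∈ball ℓ uw (walk⇒∈ball wv)

    distLe⇒∈ball : ∀ {u k} → DistLe G u v k → u ∈ ball k
    distLe⇒∈ball (m , m≤k , uv) = ball-mono (≤⇒≤′ m≤k) (walk⇒∈ball uv)

mainTheorem4 : ∀ (n : ℕ) (G : Graph n) (δ Δ k : ℕ) →
    MinDegree G δ → MaxDegree G Δ → 3 ≤ Δ → Diameter G k →
    n ≤ 2 * δ * (Δ ∸ 1) ^ (k ∸ 1) + 1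
mainTheorem4 n G δ Δ k (_ , v , degv≡δ) (maxDeg , _) 3≤Δ (diam , _) = begin
  n                                    ≤⟨ covering⇒length≥ (ball k) (λ u → distLe⇒∈ball (diam u v)) ⟩
  length (ball k)                      ≤⟨ length-ball maxDeg k ⟩
  suc (degree G v * geometricSum d k)  ≡⟨ cong (λ δ′ → suc (δ′ * geometricSum d k)) degv≡δ ⟩
  suc (δ * geometricSum d k)           ≤⟨ s≤s (*-monoʳ-≤ δ (geometricSum-≤ (∸-monoˡ-≤ 1 3≤Δ) k)) ⟩
  suc (δ * (2 * d ^ (k ∸ 1)))          ≡⟨ cong suc (sym (*-assoc δ 2 _)) ⟩
  suc (δ * 2 * d ^ (k ∸ 1))            ≡⟨ cong (λ x → suc (x * d ^ (k ∸ 1))) (*-comm δ 2) ⟩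
  suc (2 * δ * d ^ (k ∸ 1))            ≡⟨ +-comm 1 _ ⟩
  2 * δ * d ^ (k ∸ 1) + 1              ∎
  where
  open ≤-Reasoning
  open NonBacktrackingBalls G v
  d = Δ ∸ 1
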